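{- Let $\mathcal{G}$ be the class of bipartite graphs $G$ with $\mathrm{ch}(G)=1$. Then $\mathsf{D}^{\mathrm{Eq}}(\mathcal{G})\le 2$.
   Context: Chain-index $\mathrm{ch}(G)$: the largest $k$ such that there are $2k$ distinct vertices $a_1,\dots,a_k,b_1,\dots,b_k$ with, for all $i<j$, $a_ib_j$ an edge and $b_ia_j$ a non-edge. $\mathsf{D}^{\mathrm{Eq}}$: for $M\in\{\pm1\}^{X\times Y}$, $\mathsf{D}^{\mathrm{Eq}}(M)$ is the minimum depth of a rooted binary tree in which each internal node $v$ carries functions $\alpha_v:X\to\mathbb{N}$, $\beta_v:Y\to\mathbb{N}$ and each leaf a value in $\{\pm1\}$, such that for every $(x,y)$, walking from the root (right child if $\alpha_v(x)=\beta_v(y)$, left otherwise) reaches a leaf with value $M(x,y)$. $\mathsf{D}^{\mathrm{Eq}}(\mathcal{G})\le 2$ means $\mathsf{D}^{\mathrm{Eq}}(\mathrm{Adj}_G)\le 2$ for every $G\in\mathcal{G}$, where $\mathrm{Adj}_G$ is the adjacency matrix of $G$ ($1$ iff the two vertices are adjacent). -}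

module Defs where

open import Data.Nat using (ℕ; zero; suc; _≤_; _≡ᵇ_; _⊔_)
open import Data.Fin using (Fin)
open import Data.Bool using (Bool; true; false; if_then_else_; _≟_)
open import Data.Product using (Σ; _×_; _,_; ∃)
open import Relation.Binary.PropositionalEquality using (_≡_; _≢_)
open import Relation.Nullary using (¬_)
open import Function.Definitions using (Injective)

record Graph : Set where
  field
    n     : ℕ
    adj   : Fin n → Fin n → Bool
    sym   : ∀ u v → adj u v ≡ adj v u
    irrefl : ∀ v → adj v v ≡ false

open Graph public

Vertex : Graph → Set
Vertex G = Fin (n G)

Bipartite : Graph → Set
Bipartite G = Σ (Vertex G → Bool) λ c →
  ∀ u v → adj G u v ≡ true → c u ≢ c v

HasChain : Graph → ℕ → Set
HasChain G k = Σ (Fin k → Vertex G) λ a → Σ (Fin k → Vertex G) λ b →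
  Injective _≡_ _≡_ a × Injective _≡_ _≡_ b × (∀ i j → a i ≢ b j) ×
  (∀ i j → i Data.Fin.< j → adj G (a i) (b j) ≡ true × adj G (b i) (a j) ≡ false)

ChainIndexIs : Graph → ℕ → Set
ChainIndexIs G k = HasChain G k × (∀ m → HasChain G m → m ≤ k)

-- Equality decision trees. Leaf values: true represents +1, false represents -1.
data EqTree (X Y : Set) : Set where
  leaf : Bool → EqTree X Y
  node : (X → ℕ) → (Y → ℕ) → (left right : EqTree X Y) → EqTree X Y

depth : ∀ {X Y} → EqTree X Y → ℕ
depth (leaf _) = zero
depth (node _ _ l r) = suc (depth l ⊔ depth r)

eval : ∀ {X Y} → EqTree X Y → X → Y → Bool
eval (leaf b) x y = b
eval (node α β l r) x y = if α x ≡ᵇ β y then eval r x y else eval l x y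

DEqAtMost : ∀ {X Y : Set} → (X → Y → Bool) → ℕ → Set
DEqAtMost {X} {Y} M d = Σ (EqTree X Y) λ T →
  depth T ≤ d × (∀ x y → eval T x y ≡ M x y)

-- adjacency matrix (true = +1 = adjacent)
Adj : (G : Graph) → Vertex G → Vertex G → Bool
Adj G = adj G

-- Colour G properly. Same-coloured vertices are never adjacent, and the root of the
-- tree compares colours. Across the two sides, fix an edge pq: every non-edge st with
-- s ≠ t must meet {p, q}, for otherwise a = (p, t), b = (s, q) is a chain of length 2;
-- and no non-edge lies inside {p, q}. Hence G has no three distinct pairwise
-- non-adjacent vertices, so each y has at most one non-neighbour x on the other side,
-- and the second level of the tree asks whether x is that vertex. An edgeless graph
-- is a single leaf.
module Submission where

open import Defs hiding (sym)
open import Data.Nat using (ℕ; _≡ᵇ_; z≤n; s≤s)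
open import Data.Nat.Properties using (≡ᵇ⇒≡; ≡⇒≡ᵇ; <⇒≢)
open import Data.Fin using (Fin; toℕ; zero; suc; _<_)
open import Data.Fin.Properties using (any?; toℕ-injective; toℕ<n; _≟_)
open import Data.Vec using (lookup; []; _∷_)
open import Data.List using ([]; _∷_)
open import Data.List.Membership.Propositional using (_∈_; _∉_)
import Data.List.Membership.DecPropositional as DecMembership
open import Data.List.Relation.Unary.Any using (here; there)
open import Data.Bool using (Bool; true; false; T)
open import Data.Bool.Properties using (¬-not; T-≡) renaming (_≟_ to _≟ᴮ_)
open import Data.Product using (∃; _×_; _,_; proj₂)
open import Data.Empty using (⊥; ⊥-elim)
open import Function.Bundles using (_⇔_; mk⇔; Equivalence)
open import Function.Definitions using (Injective)
open import Relation.Nullary using (¬_; Dec; yes; no; contradiction)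
open import Relation.Binary.PropositionalEquality
  using (_≡_; _≢_; refl; sym; trans; cong; subst)

eval-node : ∀ {X Y} (α : X → ℕ) (β : Y → ℕ) (l r : EqTree X Y) {x y b} →
            (α x ≡ β y → eval r x y ≡ b) → (α x ≢ β y → eval l x y ≡ b) →
            eval (node α β l r) x y ≡ b
eval-node α β l r {x} {y} onEq onNe with α x ≡ᵇ β y in eq
... | true  = onEq (≡ᵇ⇒≡ _ _ (Equivalence.from T-≡ eq))
... | false = onNe (λ e → subst T eq (≡⇒≡ᵇ _ _ e))

depth2-tree : ∀ {X Y : Set} (M : X → Y → Bool) (α₁ α₂ : X → ℕ) (β₁ β₂ : Y → ℕ) →
              (∀ x y → α₁ x ≡ β₁ y → M x y ≡ false) →
              (∀ x y → α₁ x ≢ β₁ y → M x y ≡ false ⇔ α₂ x ≡ β₂ y) →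
              DEqAtMost M 2
depth2-tree {X} {Y} M α₁ α₂ β₁ β₂ firstTest secondTest =
  node α₁ β₁ secondLevel (leaf false) , s≤s (s≤s z≤n) , correct
  where
  secondLevel : EqTree X Y
  secondLevel = node α₂ β₂ (leaf true) (leaf false)

  correct : ∀ x y → eval (node α₁ β₁ secondLevel (leaf false)) x y ≡ M x y
  correct x y =
    eval-node α₁ β₁ secondLevel (leaf false) (λ e₁ → sym (firstTest x y e₁)) λ ne₁ →
      let open Equivalence (secondTest x y ne₁) in
      eval-node α₂ β₂ (leaf true) (leaf false)
        (λ e₂ → sym (from e₂))
        (λ ne₂ → sym (¬-not (λ m → ne₂ (to m))))

module _ {A : Set} {n : ℕ} (R : A → Fin n → Set) (R? : ∀ a i → Dec (R a i)) where

  private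
    indexOf : ∀ {a} → Dec (∃ (R a)) → ℕ
    indexOf (yes (i , _)) = toℕ i
    indexOf (no _)        = n

    indexOf-spec : (∀ {a i j} → R a i → R a j → i ≡ j) →
                   ∀ {a} (d : Dec (∃ (R a))) i → R a i ⇔ toℕ i ≡ indexOf d
    indexOf-spec functional {a} (yes (j , Rj)) i =
      mk⇔ (λ Ri → cong toℕ (functional Ri Rj)) (λ e → subst (R a) (sym (toℕ-injective e)) Rj)
    indexOf-spec functional (no noWitness) i =
      mk⇔ (λ Ri → contradiction (i , Ri) noWitness) (λ e → contradiction e (<⇒≢ (toℕ<n i)))

  witnessIndex : A → ℕ
  witnessIndex a = indexOf (any? (R? a))

  witnessIndex-spec : (∀ {a i j} → R a i → R a j → i ≡ j) →
                      ∀ a i → R a i ⇔ toℕ i ≡ witnessIndex a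
  witnessIndex-spec functional a = indexOf-spec functional (any? (R? a))

constant-false-tree : ∀ {X Y : Set} {M : X → Y → Bool} {d} →
                      (∀ x y → M x y ≡ false) → DEqAtMost M d
constant-false-tree allFalse = leaf false , z≤n , λ x y → sym (allFalse x y)

pair-injective : ∀ {A : Set} {x y : A} → x ≢ y → Injective _≡_ _≡_ (lookup (x ∷ y ∷ []))
pair-injective _   {zero}     {zero}     _ = refl
pair-injective _   {suc zero} {suc zero} _ = refl
pair-injective x≢y {zero}     {suc zero} e = contradiction e x≢y
pair-injective x≢y {suc zero} {zero}     e = contradiction (sym e) x≢y

≢-same-≡ : ∀ {a b c : Bool} → a ≢ c → b ≢ c → a ≡ b
≢-same-≡ a≢c b≢c = trans (¬-not a≢c) (sym (¬-not b≢c))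

bool→ℕ : Bool → ℕ
bool→ℕ false = 0
bool→ℕ true  = 1

bool→ℕ-injective : Injective _≡_ _≡_ bool→ℕ
bool→ℕ-injective {false} {false} _ = refl
bool→ℕ-injective {true}  {true}  _ = refl

module _ (G : Graph) where

  private
    V : Set
    V = Vertex G

  adjacent⇒≢ : ∀ {u v : V} → adj G u v ≡ true → u ≢ v
  adjacent⇒≢ {u} uv refl = contradiction (trans (sym uv) (irrefl G u)) λ ()

  chain₂ : ∀ {a₁ a₂ b₁ b₂ : V} → adj G a₁ b₂ ≡ true → adj G b₁ a₂ ≡ false →
           a₁ ≢ a₂ → b₁ ≢ b₂ → a₁ ≢ b₁ → a₂ ≢ b₁ → a₂ ≢ b₂ → HasChain G 2
  chain₂ {a₁} {a₂} {b₁} {b₂} a₁b₂ b₁a₂ a₁≢a₂ b₁≢b₂ a₁≢b₁ a₂≢b₁ a₂≢b₂ =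
    a , b , pair-injective a₁≢a₂ , pair-injective b₁≢b₂ , distinct , ordered
    where
    a b : Fin 2 → V
    a = lookup (a₁ ∷ a₂ ∷ [])
    b = lookup (b₁ ∷ b₂ ∷ [])

    distinct : ∀ i j → a i ≢ b j
    distinct zero       zero       = a₁≢b₁
    distinct zero       (suc zero) = adjacent⇒≢ a₁b₂
    distinct (suc zero) zero       = a₂≢b₁
    distinct (suc zero) (suc zero) = a₂≢b₂

    ordered : ∀ i j → i < j → adj G (a i) (b j) ≡ true × adj G (b i) (a j) ≡ false
    ordered zero       (suc zero) _ = a₁b₂ , b₁a₂
    ordered zero       zero       ()
    ordered (suc zero) zero       ()
    ordered (suc zero) (suc zero) (s≤s ())

  NonEdge : V → V → Set
  NonEdge u v = u ≢ v × adj G u v ≡ false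

  nonEdge-⊈-edge : ∀ {p q s t} → adj G p q ≡ true → NonEdge s t →
                   s ∈ p ∷ q ∷ [] → t ∈ p ∷ q ∷ [] → ⊥
  nonEdge-⊈-edge pq (s≢t , st) (here refl)         (here refl)         = s≢t refl
  nonEdge-⊈-edge pq (s≢t , st) (here refl)         (there (here refl)) =
    contradiction (trans (sym pq) st) λ ()
  nonEdge-⊈-edge {p} {q} pq (s≢t , st) (there (here refl)) (here refl) =
    contradiction (trans (sym pq) (trans (Graph.sym G p q) st)) λ ()
  nonEdge-⊈-edge pq (s≢t , st) (there (here refl)) (there (here refl)) = s≢t refl

  module _ (no-2-chain : ¬ HasChain G 2) {p q : V} (pq : adj G p q ≡ true) where

    open DecMembership (_≟_ {n = n G}) using (_∈?_)

    nonEdge-meets-edge : ∀ {s t} → NonEdge s t → s ∉ p ∷ q ∷ [] → t ∉ p ∷ q ∷ [] → ⊥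
    nonEdge-meets-edge (s≢t , st) s∉ t∉ = no-2-chain
      (chain₂ pq st (λ e → t∉ (here (sym e))) (λ e → s∉ (there (here e)))
              (λ e → s∉ (here (sym e))) (λ e → s≢t (sym e)) (λ e → t∉ (there (here e))))

    no-independent-triple : ∀ {x y z} → NonEdge x y → NonEdge y z → NonEdge x z → ⊥
    no-independent-triple {x} {y} xy yz xz with x ∈? p ∷ q ∷ [] | y ∈? p ∷ q ∷ []
    ... | yes x∈ | _      =
      nonEdge-meets-edge yz (nonEdge-⊈-edge pq xy x∈) (nonEdge-⊈-edge pq xz x∈)
    ... | no x∉  | yes y∈ = nonEdge-meets-edge xz x∉ (nonEdge-⊈-edge pq yz y∈)
    ... | no x∉  | no y∉  = nonEdge-meets-edge xy x∉ y∉

    module _ (c : V → Bool) (proper : ∀ u v → adj G u v ≡ true → c u ≢ c v) where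

      sameColour⇒nonadjacent : ∀ {u v} → c u ≡ c v → adj G u v ≡ false
      sameColour⇒nonadjacent {u} {v} cu≡cv = ¬-not (λ uv → proper u v uv cu≡cv)

      OppositeNonNeighbour : V → V → Set
      OppositeNonNeighbour y x = c x ≢ c y × adj G x y ≡ false

      oppositeNonNeighbour? : ∀ y x → Dec (OppositeNonNeighbour y x)
      oppositeNonNeighbour? y x with c x ≟ᴮ c y | adj G x y ≟ᴮ false
      ... | yes same | _       = no λ (opposite , _) → opposite same
      ... | no opp   | yes xy  = yes (opp , xy)
      ... | no _     | no ¬xy  = no λ (_ , xy) → ¬xy xy

      oppositeNonNeighbour-unique : ∀ {y x₁ x₂} → OppositeNonNeighbour y x₁ →
                                    OppositeNonNeighbour y x₂ → x₁ ≡ x₂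
      oppositeNonNeighbour-unique {y} {x₁} {x₂} (opp₁ , x₁y) (opp₂ , x₂y) with x₁ ≟ x₂
      ... | yes x₁≡x₂ = x₁≡x₂
      ... | no  x₁≢x₂ = ⊥-elim (no-independent-triple
              (x₁≢x₂ , sameColour⇒nonadjacent (≢-same-≡ opp₁ opp₂))
              ((λ e → opp₂ (cong c e)) , x₂y)
              ((λ e → opp₁ (cong c e)) , x₁y))

      adjacency-depth2 : DEqAtMost (Adj G) 2
      adjacency-depth2 = depth2-tree (Adj G) colour toℕ colour
        (witnessIndex OppositeNonNeighbour oppositeNonNeighbour?)
        (λ x y e → sameColour⇒nonadjacent (bool→ℕ-injective e))
        (λ x y ne → let opposite = λ e → ne (cong bool→ℕ e) in
          mk⇔ (λ xy → Equivalence.to (spec y x) (opposite , xy))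
              (λ e → proj₂ (Equivalence.from (spec y x) e)))
        where
        colour : V → ℕ
        colour v = bool→ℕ (c v)
        spec : ∀ y x → OppositeNonNeighbour y x ⇔
                       toℕ x ≡ witnessIndex OppositeNonNeighbour oppositeNonNeighbour? y
        spec = witnessIndex-spec OppositeNonNeighbour oppositeNonNeighbour?
                                 oppositeNonNeighbour-unique

proposition3p9 : (G : Graph) → Bipartite G → ChainIndexIs G 1 → DEqAtMost (Adj G) 2
proposition3p9 G (c , proper) (_ , maximal)
  with any? (λ u → any? λ v → adj G u v ≟ᴮ true)
... | yes (p , q , pq) = adjacency-depth2 G no-2-chain pq c proper
  where
  no-2-chain : ¬ HasChain G 2
  no-2-chain chain with maximal 2 chain
  ... | s≤s ()
... | no edgeless = constant-false-tree λ x y → ¬-not λ xy → edgeless (x , y , xy)
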